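{- Let $C_{n,j}$ (for $n\ge 0$, $1\le j\le n$) be the expected number of key comparisons of dual-pivot quickselect to select the $j$th smallest element of a uniformly random permutation of $\{1,\dots,n\}$, with a partitioning strategy of expected partitioning cost $P_n$ ($n\ge2$), $P_0=P_1=0$. Define the formal power series $C(z,u)=\sum_{n\ge0}\sum_{j=1}^{n}C_{n,j}z^nu^j$ and $P(z)=\sum_{n\ge0}P_nz^n$. Then \[ \frac{\partial^2}{\partial z^2}C(z,u)=\frac{u}{1-u}\bigl(P''(z)-u^2P''(zu)\bigr)+2\,C(z,u)\,r(z,u), \qquad r(z,u)=\frac{1}{(1-z)^2}+\frac{u}{(1-z)(1-zu)}+\frac{u^2}{(1-zu)^2}. \] Moreover, at $u=1$, \[ \frac{\partial^2}{\partial z^2}C(z,u)\Big|_{u=1}=\frac1z\bigl(z^2P''(z)\bigr)'+\frac{6}{(1-z)^2}\,C(z,1). \]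
   Context: Dual-pivot quickselect: on input a list of $n$ distinct keys and a rank $j$, if $n\le1$ nothing is done; otherwise the first and last elements are compared (one comparison), the smaller is pivot $p$, the larger pivot $q$, and each of the other $n-2$ elements is classified as small ($<p$), medium ($p<x<q$) or large ($>q$) by comparing it first with one pivot chosen by the partitioning strategy and, if needed, with the other pivot. With $s,m$ the numbers of small and medium elements, the algorithm recurses on the small elements with rank $j$ if $j\le s$, returns $p$ if $j=s+1$, recurses on the medium elements with rank $j-s-1$ if $s+2\le j\le s+m+1$, returns $q$ if $j=s+m+2$, and otherwise recurses on the large elements with rank $j-s-m-2$. Cost is the number of key comparisons; the input is a uniformly random permutation, and the strategy is assumed to preserve randomness (sublists passed to recursive calls are, conditioned on their sizes, uniformly random permutations). $P_n$ is the expected number of comparisons of one partitioning step on $n\ge2$ elements, including the pivot comparison. The expression $\frac{u}{1-u}(P''(z)-u^2P''(zu))$ is understood as the formal power series $\sum_{n\ge2}n(n-1)P_nz^{n-2}\sum_{j=1}^n u^j$. -}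

module Defs where

open import Data.Nat as ℕ using (ℕ; zero; suc; _∸_; _≤ᵇ_; _≡ᵇ_)
open import Data.Bool using (Bool; true; false; if_then_else_; _∧_)
open import Data.Integer using (+_)
open import Data.Rational using (ℚ; 0ℚ; 1ℚ; _/_; _+_; _*_)

ℕ→ℚ : ℕ → ℚ
ℕ→ℚ n = + n / 1

sumTo : ℕ → (ℕ → ℚ) → ℚ
sumTo zero    f = f 0
sumTo (suc n) f = sumTo n f + f (suc n)

-- For a partitioning step on n ≥ 2 elements the pivot pair (p,q) is a
-- uniformly random pair of ranks a < b among the C(n,2) pairs; then
-- s = a-1, m = b-a-1, l = n-b, i.e. (s,m,l) ranges over all triples of
-- naturals with s+m+l = n-2, each with probability 1/C(n,2) = 2/(n(n-1)).
-- Randomness preservation makes the expected cost of the recursive call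
-- on a sublist of size k with rank i equal to C_{k,i}.
contrib : (ℕ → ℕ → ℚ) → ℕ → ℕ → ℕ → ℕ → ℚ
contrib rec n j s m =
  if j ≤ᵇ s then rec s j
  else if j ≡ᵇ suc s then 0ℚ
  else if j ≤ᵇ suc (s ℕ.+ m) then rec m (j ∸ suc s)
  else if j ≡ᵇ suc (suc (s ℕ.+ m)) then 0ℚ
  else rec (n ∸ 2 ∸ s ∸ m) (j ∸ suc (suc (s ℕ.+ m)))

-- Fuel-driven definition; the fuel f only needs to satisfy f ≥ n
-- (recursive calls are on sizes ≤ n-2), and we always use f = n.
costF : (P : ℕ → ℚ) → ℕ → ℕ → ℕ → ℚ
costF P zero    n             j = 0ℚ
costF P (suc f) zero          j = 0ℚ
costF P (suc f) (suc zero)    j = 0ℚ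
costF P (suc f) (suc (suc k)) j =
  P (suc (suc k)) +
  (+ 2 / (suc (suc k) ℕ.* suc k)) *
    sumTo k (λ s → sumTo (k ∸ s) (λ m → contrib (costF P f) (suc (suc k)) j s m))

Cexp : (P : ℕ → ℚ) → ℕ → ℕ → ℚ
Cexp P n j = costF P n n j

-- Formal power series (coefficient functions).
-- Series2: f n j is the coefficient of z^n u^j.  Series1: coefficient of z^n.

Series1 : Set
Series1 = ℕ → ℚ

Series2 : Set
Series2 = ℕ → ℕ → ℚ

infixl 6 _⊕_ _⊕₁_
infixl 7 _⊛_ _⊛₁_ _·_ _·₁_

_⊕_ : Series2 → Series2 → Series2
(f ⊕ g) n j = f n j + g n j

_·_ : ℚ → Series2 → Series2
(c · f) n j = c * f n j

_⊛_ : Series2 → Series2 → Series2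
(f ⊛ g) n j = sumTo n (λ a → sumTo j (λ b → f a b * g (n ∸ a) (j ∸ b)))

∂z : Series2 → Series2
∂z f n j = ℕ→ℚ (suc n) * f (suc n) j

uPow : ℕ → Series2
uPow k n j = if (n ≡ᵇ 0) ∧ (j ≡ᵇ k) then 1ℚ else 0ℚ

geoZ : Series2
geoZ n j = if j ≡ᵇ 0 then 1ℚ else 0ℚ

geoZU : Series2
geoZU n j = if j ≡ᵇ n then 1ℚ else 0ℚ

r : Series2
r = geoZ ⊛ geoZ ⊕ uPow 1 ⊛ geoZ ⊛ geoZU ⊕ uPow 2 ⊛ geoZU ⊛ geoZU

Cser : (ℕ → ℚ) → Series2
Cser P n j = if (1 ≤ᵇ j) ∧ (j ≤ᵇ n) then Cexp P n j else 0ℚ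

-- u/(1-u) (P''(z) - u^2 P''(zu)), understood as
-- Σ_{n≥2} n(n-1) P_n z^{n-2} Σ_{j=1}^{n} u^j
Pterm : (ℕ → ℚ) → Series2
Pterm P n j =
  if (1 ≤ᵇ j) ∧ (j ≤ᵇ suc (suc n))
  then ℕ→ℚ (suc (suc n) ℕ.* suc n) * P (suc (suc n)) else 0ℚ

-- Substitution u = 1 for a series whose z^n coefficient is a polynomial in
-- u of degree ≤ d n.
atU1 : (ℕ → ℕ) → Series2 → Series1
atU1 d f n = sumTo (d n) (λ j → f n j)

_⊕₁_ : Series1 → Series1 → Series1
(f ⊕₁ g) n = f n + g n

_·₁_ : ℚ → Series1 → Series1
(c ·₁ f) n = c * f n

_⊛₁_ : Series1 → Series1 → Series1
(f ⊛₁ g) n = sumTo n (λ a → f a * g (n ∸ a))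

d₁ : Series1 → Series1
d₁ f n = ℕ→ℚ (suc n) * f (suc n)

z²· : Series1 → Series1
z²· f zero = 0ℚ
z²· f (suc zero) = 0ℚ
z²· f (suc (suc n)) = f n

-- division by z (valid for series with zero constant term)
z⁻¹· : Series1 → Series1
z⁻¹· f n = f (suc n)

geo₁ : Series1
geo₁ n = 1ℚ

-- Comparing coefficients of z^n u^j, the first identity is the recurrence for
-- C_{n+2,j} multiplied by (n+2)(n+1).  For sublist sizes s, m, l = n - s - m the
-- recursive call costs C_{s,j}, C_{m,j-s-1} or C_{l,j-s-m-2}; reading C_{k,i} as 0
-- outside 1 ≤ i ≤ k, this is the sum of all three.  Summed over the compositions
-- s + m + l = n these are exactly the three parts of the convolution C(z,u) r(z,u):
-- 1/(1-z)^2 has coefficient (k+1)[i = 0] and counts the pairs (m, l);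
-- u/((1-z)(1-zu)) has coefficient [1 ≤ i ≤ k+1], one shift of the rank by s+1 for
-- each s; u^2/(1-zu)^2 has coefficient (k+1)[i = k+2], a shift by s+m+2 for each
-- split of s+m.  At u = 1 one sums over j: a composition contributes the row sums
-- of its three sublists, and each size a occurs n-a+1 times in every position,
-- which gives 3 (and with the factor 2, 6) copies of 1/(1-z)^2 C(z,1).

module Submission where

open import Defs
open import Data.Nat using (ℕ; _+_)
open import Data.Rational using (ℚ; 0ℚ; _/_)
open import Data.Integer using (+_)
open import Data.Product using (_×_)
open import Relation.Binary.PropositionalEquality using (_≡_)

open import Algebra.Bundles using (CommutativeMonoid)
open import Data.Bool using (true; false; if_then_else_; _∧_)
import Data.Integer as ℤ
import Data.Integer.Properties as ℤₚ
open import Data.Nat as ℕ using (zero; suc; _∸_; _≤_; _<_; _≤ᵇ_; _≡ᵇ_; z≤n; s≤s; _≤?_)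
open import Data.Nat.Properties
open import Data.Product using (_,_)
open import Data.Rational as ℚ using (1ℚ)
import Data.Rational.Properties as ℚₚ
open import Data.Rational.Solver using (module +-*-Solver)
import Data.Rational.Unnormalised as ℚᵘ
import Data.Rational.Unnormalised.Properties as ℚᵘₚ
open import Data.Sum using (inj₁; inj₂)
open import Relation.Binary.PropositionalEquality
open import Relation.Nullary using (yes; no; contradiction)
open import Relation.Nullary.Reflects using (Reflects; ofʸ; ofⁿ; fromEquivalence)

open import Algebra.Properties.CommutativeSemigroup
  (CommutativeMonoid.commutativeSemigroup ℚₚ.*-1-commutativeMonoid)
  using (x∙yz≈y∙xz; x∙yz≈yx∙z; xy∙z≈y∙xz)
open import Algebra.Properties.CommutativeSemigroup
  (CommutativeMonoid.commutativeSemigroup ℚₚ.+-0-commutativeMonoid)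
  using () renaming (interchange to +-interchange)

toℚᵘ-ℕ→ℚ : ∀ n → ℚ.toℚᵘ (ℕ→ℚ n) ℚᵘ.≃ ℚᵘ.mkℚᵘ (+ n) 0
toℚᵘ-ℕ→ℚ n = ℚₚ.toℚᵘ-fromℚᵘ (ℚᵘ.mkℚᵘ (+ n) 0)

ℕ→ℚ-+ : ∀ m n → ℕ→ℚ (m + n) ≡ ℕ→ℚ m ℚ.+ ℕ→ℚ n
ℕ→ℚ-+ m n = ℚₚ.toℚᵘ-injective (begin
  ℚ.toℚᵘ (ℕ→ℚ (m + n))                    ≈⟨ toℚᵘ-ℕ→ℚ (m + n) ⟩
  ℚᵘ.mkℚᵘ (+ (m + n)) 0                    ≈⟨ ℚᵘ.*≡* (cong (ℤ._* + 1) pos-sum) ⟩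
  ℚᵘ.mkℚᵘ (+ m) 0 ℚᵘ.+ ℚᵘ.mkℚᵘ (+ n) 0    ≈⟨ ℚᵘₚ.+-cong (toℚᵘ-ℕ→ℚ m) (toℚᵘ-ℕ→ℚ n) ⟨
  ℚ.toℚᵘ (ℕ→ℚ m) ℚᵘ.+ ℚ.toℚᵘ (ℕ→ℚ n)    ≈⟨ ℚₚ.toℚᵘ-homo-+ (ℕ→ℚ m) (ℕ→ℚ n) ⟨
  ℚ.toℚᵘ (ℕ→ℚ m ℚ.+ ℕ→ℚ n)                ∎)
  where
  open ℚᵘₚ.≃-Reasoning
  pos-sum : + (m + n) ≡ + m ℤ.* + 1 ℤ.+ + n ℤ.* + 1
  pos-sum = trans (ℤₚ.pos-+ m n) (sym (cong₂ ℤ._+_ (ℤₚ.*-identityʳ (+ m)) (ℤₚ.*-identityʳ (+ n))))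

ℕ→ℚ-* : ∀ m n → ℕ→ℚ (m ℕ.* n) ≡ ℕ→ℚ m ℚ.* ℕ→ℚ n
ℕ→ℚ-* m n = ℚₚ.toℚᵘ-injective (begin
  ℚ.toℚᵘ (ℕ→ℚ (m ℕ.* n))                  ≈⟨ toℚᵘ-ℕ→ℚ (m ℕ.* n) ⟩
  ℚᵘ.mkℚᵘ (+ (m ℕ.* n)) 0                  ≈⟨ ℚᵘ.*≡* (cong (ℤ._* + 1) (ℤₚ.pos-* m n)) ⟩
  ℚᵘ.mkℚᵘ (+ m) 0 ℚᵘ.* ℚᵘ.mkℚᵘ (+ n) 0    ≈⟨ ℚᵘₚ.*-cong (toℚᵘ-ℕ→ℚ m) (toℚᵘ-ℕ→ℚ n) ⟨
  ℚ.toℚᵘ (ℕ→ℚ m) ℚᵘ.* ℚ.toℚᵘ (ℕ→ℚ n)    ≈⟨ ℚₚ.toℚᵘ-homo-* (ℕ→ℚ m) (ℕ→ℚ n) ⟨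
  ℚ.toℚᵘ (ℕ→ℚ m ℚ.* ℕ→ℚ n)                ∎)
  where open ℚᵘₚ.≃-Reasoning

ℕ→ℚ-*-/ : ∀ k d → ℕ→ℚ (suc d) ℚ.* (+ k / suc d) ≡ ℕ→ℚ k
ℕ→ℚ-*-/ k d = ℚₚ.toℚᵘ-injective (begin
  ℚ.toℚᵘ (ℕ→ℚ (suc d) ℚ.* (+ k / suc d))
    ≈⟨ ℚₚ.toℚᵘ-homo-* (ℕ→ℚ (suc d)) (+ k / suc d) ⟩
  ℚ.toℚᵘ (ℕ→ℚ (suc d)) ℚᵘ.* ℚ.toℚᵘ (+ k / suc d)
    ≈⟨ ℚᵘₚ.*-cong (toℚᵘ-ℕ→ℚ (suc d)) (ℚₚ.toℚᵘ-fromℚᵘ (ℚᵘ.mkℚᵘ (+ k) d)) ⟩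
  ℚᵘ.mkℚᵘ (+ suc d) 0 ℚᵘ.* ℚᵘ.mkℚᵘ (+ k) d
    ≈⟨ ℚᵘ.*≡* cancel ⟩
  ℚᵘ.mkℚᵘ (+ k) 0
    ≈⟨ toℚᵘ-ℕ→ℚ k ⟨
  ℚ.toℚᵘ (ℕ→ℚ k)
    ∎)
  where
  open ℚᵘₚ.≃-Reasoning
  cancel : (+ suc d ℤ.* + k) ℤ.* + 1 ≡ + k ℤ.* + (1 ℕ.* suc d)
  cancel = trans (ℤₚ.*-identityʳ (+ suc d ℤ.* + k))
                 (trans (ℤₚ.*-comm (+ suc d) (+ k)) (cong (λ t → + k ℤ.* + t) (sym (*-identityˡ (suc d)))))

≡ᵇ-reflects-≡ : ∀ m n → Reflects (m ≡ n) (m ≡ᵇ n)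
≡ᵇ-reflects-≡ m n = fromEquivalence (≡ᵇ⇒≡ m n) (≡⇒≡ᵇ m n)

δ : ℕ → ℕ → ℚ
δ i c = if i ≡ᵇ c then 1ℚ else 0ℚ

δ-≢ : ∀ {i c} → i ≢ c → δ i c ≡ 0ℚ
δ-≢ {i} {c} i≢c with i ≡ᵇ c | ≡ᵇ-reflects-≡ i c
... | true  | ofʸ i≡c = contradiction i≡c i≢c
... | false | _        = refl

δ-∸ : ∀ i d y → δ (i ∸ d) (suc y) ≡ δ i (suc y + d)
δ-∸ i       zero    y = cong (δ i) (sym (+-identityʳ (suc y)))
δ-∸ zero    (suc d) y = refl
δ-∸ (suc i) (suc d) y = trans (δ-∸ i d y) (cong (δ i) (sym (+-suc y d)))

sumTo-cong : ∀ N {f g : ℕ → ℚ} → (∀ x → x ≤ N → f x ≡ g x) → sumTo N f ≡ sumTo N g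
sumTo-cong zero    f≗g = f≗g 0 z≤n
sumTo-cong (suc N) f≗g =
  cong₂ ℚ._+_ (sumTo-cong N (λ x x≤N → f≗g x (m≤n⇒m≤1+n x≤N))) (f≗g (suc N) ≤-refl)

sumTo-0 : ∀ N → sumTo N (λ _ → 0ℚ) ≡ 0ℚ
sumTo-0 zero    = refl
sumTo-0 (suc N) = cong (ℚ._+ 0ℚ) (sumTo-0 N)

sumTo-+ : ∀ N (f g : ℕ → ℚ) → sumTo N (λ x → f x ℚ.+ g x) ≡ sumTo N f ℚ.+ sumTo N g
sumTo-+ zero    f g = refl
sumTo-+ (suc N) f g = trans (cong (ℚ._+ (f (suc N) ℚ.+ g (suc N))) (sumTo-+ N f g))
                            (+-interchange (sumTo N f) (sumTo N g) (f (suc N)) (g (suc N)))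

sumTo-*ˡ : ∀ N c (f : ℕ → ℚ) → sumTo N (λ x → c ℚ.* f x) ≡ c ℚ.* sumTo N f
sumTo-*ˡ zero    c f = refl
sumTo-*ˡ (suc N) c f = trans (cong (ℚ._+ c ℚ.* f (suc N)) (sumTo-*ˡ N c f))
                             (sym (ℚₚ.*-distribˡ-+ c (sumTo N f) (f (suc N))))

sumTo-const : ∀ N c → sumTo N (λ _ → c) ≡ ℕ→ℚ (suc N) ℚ.* c
sumTo-const zero    c = sym (ℚₚ.*-identityˡ c)
sumTo-const (suc N) c = begin
  sumTo N (λ _ → c) ℚ.+ c                  ≡⟨ cong₂ ℚ._+_ (sumTo-const N c) (sym (ℚₚ.*-identityˡ c)) ⟩
  ℕ→ℚ (suc N) ℚ.* c ℚ.+ 1ℚ ℚ.* c          ≡⟨ ℚₚ.*-distribʳ-+ c (ℕ→ℚ (suc N)) 1ℚ ⟨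
  (ℕ→ℚ (suc N) ℚ.+ 1ℚ) ℚ.* c              ≡⟨ cong (ℚ._* c) (ℕ→ℚ-+ (suc N) 1) ⟨
  ℕ→ℚ (suc N + 1) ℚ.* c                    ≡⟨ cong (λ k → ℕ→ℚ k ℚ.* c) (+-comm (suc N) 1) ⟩
  ℕ→ℚ (suc (suc N)) ℚ.* c                  ∎
  where open ≡-Reasoning

sumTo-head : ∀ N (f : ℕ → ℚ) → sumTo (suc N) f ≡ f 0 ℚ.+ sumTo N (λ x → f (suc x))
sumTo-head zero    f = refl
sumTo-head (suc N) f = trans (cong (ℚ._+ f (suc (suc N))) (sumTo-head N f)) (ℚₚ.+-assoc (f 0) _ _)

sumTo-swap : ∀ N M (f : ℕ → ℕ → ℚ) →
             sumTo N (λ x → sumTo M (f x)) ≡ sumTo M (λ y → sumTo N (λ x → f x y))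
sumTo-swap zero    M f = refl
sumTo-swap (suc N) M f = trans (cong (ℚ._+ sumTo M (f (suc N))) (sumTo-swap N M f))
                               (sym (sumTo-+ M (λ y → sumTo N (λ x → f x y)) (f (suc N))))

sumTo-reverse : ∀ N (f : ℕ → ℚ) → sumTo N f ≡ sumTo N (λ x → f (N ∸ x))
sumTo-reverse zero    f = refl
sumTo-reverse (suc N) f = begin
  sumTo N f ℚ.+ f (suc N)                          ≡⟨ cong (ℚ._+ f (suc N)) (sumTo-reverse N f) ⟩
  sumTo N (λ x → f (N ∸ x)) ℚ.+ f (suc N)          ≡⟨ ℚₚ.+-comm _ (f (suc N)) ⟩
  f (suc N) ℚ.+ sumTo N (λ x → f (suc N ∸ suc x))  ≡⟨ sumTo-head N (λ x → f (suc N ∸ x)) ⟨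
  sumTo (suc N) (λ x → f (suc N ∸ x))              ∎
  where open ≡-Reasoning

sumTo-δ : ∀ N {c} (g : ℕ → ℚ) → c ≤ N → sumTo N (λ b → δ b c ℚ.* g b) ≡ g c
sumTo-δ zero    {zero}  g z≤n       = ℚₚ.*-identityˡ (g 0)
sumTo-δ (suc N) {zero}  g z≤n       = begin
  sumTo (suc N) (λ b → δ b 0 ℚ.* g b)                     ≡⟨ sumTo-head N _ ⟩
  1ℚ ℚ.* g 0 ℚ.+ sumTo N (λ b → 0ℚ ℚ.* g (suc b))         ≡⟨ cong₂ ℚ._+_ (ℚₚ.*-identityˡ (g 0)) vanish ⟩
  g 0 ℚ.+ 0ℚ                                               ≡⟨ ℚₚ.+-identityʳ (g 0) ⟩
  g 0                                                      ∎
  where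
  open ≡-Reasoning
  vanish : sumTo N (λ b → 0ℚ ℚ.* g (suc b)) ≡ 0ℚ
  vanish = trans (sumTo-cong N (λ b _ → ℚₚ.*-zeroˡ (g (suc b)))) (sumTo-0 N)
sumTo-δ (suc N) {suc c} g (s≤s c≤N) = begin
  sumTo (suc N) (λ b → δ b (suc c) ℚ.* g b)
    ≡⟨ sumTo-head N _ ⟩
  0ℚ ℚ.* g 0 ℚ.+ sumTo N (λ b → δ b c ℚ.* g (suc b))
    ≡⟨ cong₂ ℚ._+_ (ℚₚ.*-zeroˡ (g 0)) (sumTo-δ N (λ b → g (suc b)) c≤N) ⟩
  0ℚ ℚ.+ g (suc c)
    ≡⟨ ℚₚ.+-identityˡ (g (suc c)) ⟩
  g (suc c)
    ∎
  where open ≡-Reasoning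

sumTo-δ∸ : ∀ j c (f : ℕ → ℚ) → f 0 ≡ 0ℚ → sumTo j (λ b → f b ℚ.* δ (j ∸ b) c) ≡ f (j ∸ c)
sumTo-δ∸ j c f f0≡0 with c ≤? j
... | yes c≤j = begin
  sumTo j (λ b → f b ℚ.* δ (j ∸ b) c)               ≡⟨ sumTo-reverse j _ ⟩
  sumTo j (λ t → f (j ∸ t) ℚ.* δ (j ∸ (j ∸ t)) c)   ≡⟨ sumTo-cong j flip-term ⟩
  sumTo j (λ t → δ t c ℚ.* f (j ∸ t))               ≡⟨ sumTo-δ j (λ t → f (j ∸ t)) c≤j ⟩
  f (j ∸ c)                                          ∎
  where
  open ≡-Reasoning
  flip-term : ∀ t → t ≤ j → f (j ∸ t) ℚ.* δ (j ∸ (j ∸ t)) c ≡ δ t c ℚ.* f (j ∸ t)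
  flip-term t t≤j = trans (cong (λ u → f (j ∸ t) ℚ.* δ u c) (m∸[m∸n]≡n t≤j)) (ℚₚ.*-comm (f (j ∸ t)) (δ t c))
... | no c≰j = begin
  sumTo j (λ b → f b ℚ.* δ (j ∸ b) c)   ≡⟨ sumTo-cong j (λ b _ → cong (f b ℚ.*_) (δ-≢ (j∸b≢c b))) ⟩
  sumTo j (λ b → f b ℚ.* 0ℚ)            ≡⟨ sumTo-cong j (λ b _ → ℚₚ.*-zeroʳ (f b)) ⟩
  sumTo j (λ _ → 0ℚ)                    ≡⟨ sumTo-0 j ⟩
  0ℚ                                    ≡⟨ f0≡0 ⟨
  f 0                                   ≡⟨ cong f (m≤n⇒m∸n≡0 (<⇒≤ (≰⇒> c≰j))) ⟨
  f (j ∸ c)                             ∎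
  where
  open ≡-Reasoning
  j∸b≢c : ∀ b → j ∸ b ≢ c
  j∸b≢c b j∸b≡c = c≰j (subst (_≤ j) j∸b≡c (m∸n≤m j b))

sumTo-∸-shift : ∀ c M (g : ℕ → ℚ) → g 0 ≡ 0ℚ → sumTo (c + M) (λ j → g (j ∸ c)) ≡ sumTo M g
sumTo-∸-shift zero    M g g0≡0 = refl
sumTo-∸-shift (suc c) M g g0≡0 = begin
  sumTo (suc (c + M)) (λ j → g (j ∸ suc c))      ≡⟨ sumTo-head (c + M) _ ⟩
  g 0 ℚ.+ sumTo (c + M) (λ j → g (j ∸ c))        ≡⟨ cong₂ ℚ._+_ g0≡0 (sumTo-∸-shift c M g g0≡0) ⟩
  0ℚ ℚ.+ sumTo M g                                ≡⟨ ℚₚ.+-identityˡ (sumTo M g) ⟩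
  sumTo M g                                       ∎
  where open ≡-Reasoning

sumTo-extend : ∀ {a M} (g : ℕ → ℚ) → a ≤ M → (∀ b → a < b → g b ≡ 0ℚ) → sumTo M g ≡ sumTo a g
sumTo-extend {M = zero}  g z≤n    _     = refl
sumTo-extend {a} {suc M} g a≤1+M g≡0 with m≤n⇒m<n∨m≡n a≤1+M
... | inj₂ refl          = refl
... | inj₁ (s≤s a≤M) = begin
  sumTo M g ℚ.+ g (suc M)   ≡⟨ cong₂ ℚ._+_ (sumTo-extend g a≤M g≡0) (g≡0 (suc M) (s≤s a≤M)) ⟩
  sumTo a g ℚ.+ 0ℚ          ≡⟨ ℚₚ.+-identityʳ (sumTo a g) ⟩
  sumTo a g                 ∎
  where open ≡-Reasoning

-- Sums over compositions s + m + l = n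

sumTriangle : ℕ → (ℕ → ℕ → ℚ) → ℚ
sumTriangle n h = sumTo n (λ s → sumTo (n ∸ s) (h s))

sumTriangle-cong : ∀ n {g h : ℕ → ℕ → ℚ} → (∀ s m → s + m ≤ n → g s m ≡ h s m) →
                   sumTriangle n g ≡ sumTriangle n h
sumTriangle-cong n g≗h = sumTo-cong n (λ s s≤n → sumTo-cong (n ∸ s) (λ m m≤n∸s →
  g≗h s m (subst (_≤ n) (+-comm m s) (m≤o∸n⇒m+n≤o m s≤n m≤n∸s))))

sumTriangle-+ : ∀ n (g h : ℕ → ℕ → ℚ) →
                sumTriangle n (λ s m → g s m ℚ.+ h s m) ≡ sumTriangle n g ℚ.+ sumTriangle n h
sumTriangle-+ n g h = trans (sumTo-cong n (λ s _ → sumTo-+ (n ∸ s) (g s) (h s)))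
                            (sumTo-+ n _ _)

sumTo-sumTriangle : ∀ N n (h : ℕ → ℕ → ℕ → ℚ) →
                    sumTo N (λ j → sumTriangle n (h j)) ≡ sumTriangle n (λ s m → sumTo N (λ j → h j s m))
sumTo-sumTriangle N n h = trans (sumTo-swap N n _) (sumTo-cong n (λ s _ → sumTo-swap N (n ∸ s) _))

sumTriangle-antidiagonal : ∀ n (h : ℕ → ℕ → ℚ) →
                           sumTriangle n h ≡ sumTo n (λ d → sumTo d (λ b → h b (d ∸ b)))
sumTriangle-antidiagonal zero    h = refl
sumTriangle-antidiagonal (suc n) h = begin
  sumTriangle (suc n) h
    ≡⟨ sumTo-head n _ ⟩
  sumTo (suc n) (h 0) ℚ.+ sumTriangle n (λ s → h (suc s))
    ≡⟨ cong₂ ℚ._+_ (sumTo-head n (h 0)) (sumTriangle-antidiagonal n (λ s → h (suc s))) ⟩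
  (h 0 0 ℚ.+ sumTo n (λ d → h 0 (suc d))) ℚ.+ sumTo n (λ d → sumTo d (λ b → h (suc b) (d ∸ b)))
    ≡⟨ ℚₚ.+-assoc (h 0 0) _ _ ⟩
  h 0 0 ℚ.+ (sumTo n (λ d → h 0 (suc d)) ℚ.+ sumTo n (λ d → sumTo d (λ b → h (suc b) (d ∸ b))))
    ≡⟨ cong (h 0 0 ℚ.+_) (sumTo-+ n _ _) ⟨
  h 0 0 ℚ.+ sumTo n (λ d → h 0 (suc d) ℚ.+ sumTo d (λ b → h (suc b) (d ∸ b)))
    ≡⟨ cong (h 0 0 ℚ.+_) (sumTo-cong n (λ d _ → sumTo-head d (λ b → h b (suc d ∸ b)))) ⟨
  h 0 0 ℚ.+ sumTo n (λ d → sumTo (suc d) (λ b → h b (suc d ∸ b)))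
    ≡⟨ sumTo-head n _ ⟨
  sumTo (suc n) (λ d → sumTo d (λ b → h b (d ∸ b)))
    ∎
  where open ≡-Reasoning

sumTriangle-swap : ∀ n (h : ℕ → ℕ → ℚ) → sumTriangle n h ≡ sumTriangle n (λ s m → h m s)
sumTriangle-swap n h = begin
  sumTriangle n h                                          ≡⟨ sumTriangle-antidiagonal n h ⟩
  sumTo n (λ d → sumTo d (λ b → h b (d ∸ b)))              ≡⟨ sumTo-cong n (λ d _ → sumTo-reverse d _) ⟩
  sumTo n (λ d → sumTo d (λ b → h (d ∸ b) (d ∸ (d ∸ b))))  ≡⟨ sumTo-cong n (λ d _ → sumTo-cong d (λ b b≤d →
                                                                cong (h (d ∸ b)) (m∸[m∸n]≡n b≤d))) ⟩
  sumTo n (λ d → sumTo d (λ b → h (d ∸ b) b))              ≡⟨ sumTriangle-antidiagonal n (λ s m → h m s) ⟨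
  sumTriangle n (λ s m → h m s)                            ∎
  where open ≡-Reasoning

sumTriangle-first : ∀ n (g : ℕ → ℚ) →
                    sumTriangle n (λ s _ → g s) ≡ sumTo n (λ s → ℕ→ℚ (suc (n ∸ s)) ℚ.* g s)
sumTriangle-first n g = sumTo-cong n (λ s _ → sumTo-const (n ∸ s) (g s))

sumTriangle-last : ∀ n (g : ℕ → ℕ → ℚ) →
                   sumTriangle n (λ s m → g (n ∸ s ∸ m) (s + m))
                     ≡ sumTo n (λ l → ℕ→ℚ (suc (n ∸ l)) ℚ.* g l (n ∸ l))
sumTriangle-last n g = begin
  sumTriangle n (λ s m → g (n ∸ s ∸ m) (s + m))
    ≡⟨ sumTriangle-cong n (λ s m _ → cong (λ l → g l (s + m)) (∸-+-assoc n s m)) ⟩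
  sumTriangle n (λ s m → G (s + m))
    ≡⟨ sumTriangle-antidiagonal n _ ⟩
  sumTo n (λ d → sumTo d (λ b → G (b + (d ∸ b))))
    ≡⟨ sumTo-cong n (λ d _ → sumTo-cong d (λ b b≤d → cong G (m+[n∸m]≡n b≤d))) ⟩
  sumTo n (λ d → sumTo d (λ _ → G d))
    ≡⟨ sumTo-cong n (λ d _ → sumTo-const d (G d)) ⟩
  sumTo n (λ d → ℕ→ℚ (suc d) ℚ.* G d)
    ≡⟨ sumTo-reverse n _ ⟩
  sumTo n (λ l → ℕ→ℚ (suc (n ∸ l)) ℚ.* g (n ∸ (n ∸ l)) (n ∸ l))
    ≡⟨ sumTo-cong n (λ l l≤n → cong (λ a → ℕ→ℚ (suc (n ∸ l)) ℚ.* g a (n ∸ l)) (m∸[m∸n]≡n l≤n)) ⟩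
  sumTo n (λ l → ℕ→ℚ (suc (n ∸ l)) ℚ.* g l (n ∸ l))
    ∎
  where
  open ≡-Reasoning
  G : ℕ → ℚ
  G d = g (n ∸ d) d

-- Convolution with r

r₁ r₂ r₃ : Series2
r₁ = geoZ ⊛ geoZ
r₂ = uPow 1 ⊛ geoZ ⊛ geoZU
r₃ = uPow 2 ⊛ geoZU ⊛ geoZU

⊛-congʳ : ∀ f {g h} → (∀ k i → g k i ≡ h k i) → ∀ n j → (f ⊛ g) n j ≡ (f ⊛ h) n j
⊛-congʳ f g≗h n j = sumTo-cong n (λ a _ → sumTo-cong j (λ b _ → cong (f a b ℚ.*_) (g≗h (n ∸ a) (j ∸ b))))

⊛-distribˡ-⊕ : ∀ f g h n j → (f ⊛ (g ⊕ h)) n j ≡ (f ⊛ g) n j ℚ.+ (f ⊛ h) n j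
⊛-distribˡ-⊕ f g h n j = trans
  (sumTo-cong n (λ a _ → trans (sumTo-cong j (λ b _ → ℚₚ.*-distribˡ-+ (f a b) _ _)) (sumTo-+ j _ _)))
  (sumTo-+ n _ _)

uPow-⊛ : ∀ c g a b → (uPow c ⊛ g) a b ≡ sumTo b (λ t → δ t c ℚ.* g a (b ∸ t))
uPow-⊛ c g a b = trans
  (sumTo-cong a (λ a′ _ → trans (sumTo-cong b (λ t _ → uPow-δ a′ t _)) (sumTo-*ˡ b (δ a′ 0) _)))
  (sumTo-δ a (λ a′ → sumTo b (λ t → δ t c ℚ.* g (a ∸ a′) (b ∸ t))) z≤n)
  where
  uPow-δ : ∀ a′ t x → uPow c a′ t ℚ.* x ≡ δ a′ 0 ℚ.* (δ t c ℚ.* x)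
  uPow-δ zero     t x = sym (ℚₚ.*-identityˡ (δ t c ℚ.* x))
  uPow-δ (suc a′) t x = trans (ℚₚ.*-zeroˡ x) (sym (ℚₚ.*-zeroˡ (δ t c ℚ.* x)))

⊛-geoZU : ∀ f → (∀ a → f a 0 ≡ 0ℚ) → ∀ k i → (f ⊛ geoZU) k i ≡ sumTo k (λ a → f a (i ∸ (k ∸ a)))
⊛-geoZU f f0≡0 k i = sumTo-cong k (λ a _ → sumTo-δ∸ i (k ∸ a) (f a) (f0≡0 a))

uPow1⊛geoZ-coeff : ∀ a b → (uPow 1 ⊛ geoZ) a b ≡ δ b 1
uPow1⊛geoZ-coeff a b = trans (uPow-⊛ 1 geoZ a b) (sumTo-δ∸ b 0 (λ t → δ t 1) refl)

uPow2⊛geoZU-coeff : ∀ a b → (uPow 2 ⊛ geoZU) a b ≡ δ b (suc (suc a))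
uPow2⊛geoZU-coeff a b = trans (uPow-⊛ 2 geoZU a b) (trans (sumTo-δ∸ b a (λ t → δ t 2) refl) (δ-∸ b a 1))

r₁-coeff : ∀ k i → r₁ k i ≡ ℕ→ℚ (suc k) ℚ.* δ i 0
r₁-coeff k i = trans (sumTo-cong k (λ a _ → sumTo-δ i (λ b → δ (i ∸ b) 0) z≤n)) (sumTo-const k (δ i 0))

r₂-coeff : ∀ k i → r₂ k i ≡ sumTo k (λ s → δ i (suc s))
r₂-coeff k i = begin
  r₂ k i
    ≡⟨ ⊛-geoZU (uPow 1 ⊛ geoZ) (λ a → uPow1⊛geoZ-coeff a 0) k i ⟩
  sumTo k (λ a → (uPow 1 ⊛ geoZ) a (i ∸ (k ∸ a)))
    ≡⟨ sumTo-cong k (λ a _ →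
        trans (uPow1⊛geoZ-coeff a (i ∸ (k ∸ a))) (δ-∸ i (k ∸ a) 0)) ⟩
  sumTo k (λ a → δ i (suc (k ∸ a)))
    ≡⟨ sumTo-reverse k (λ s → δ i (suc s)) ⟨
  sumTo k (λ s → δ i (suc s))
    ∎
  where open ≡-Reasoning

r₃-coeff : ∀ k i → r₃ k i ≡ ℕ→ℚ (suc k) ℚ.* δ i (suc (suc k))
r₃-coeff k i = begin
  r₃ k i
    ≡⟨ ⊛-geoZU (uPow 2 ⊛ geoZU) (λ a → uPow2⊛geoZU-coeff a 0) k i ⟩
  sumTo k (λ a → (uPow 2 ⊛ geoZU) a (i ∸ (k ∸ a)))
    ≡⟨ sumTo-cong k coeff ⟩
  sumTo k (λ _ → δ i (suc (suc k)))
    ≡⟨ sumTo-const k _ ⟩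
  ℕ→ℚ (suc k) ℚ.* δ i (suc (suc k))
    ∎
  where
  open ≡-Reasoning
  coeff : ∀ a → a ≤ k → (uPow 2 ⊛ geoZU) a (i ∸ (k ∸ a)) ≡ δ i (suc (suc k))
  coeff a a≤k = trans (uPow2⊛geoZU-coeff a (i ∸ (k ∸ a)))
                      (trans (δ-∸ i (k ∸ a) (suc a)) (cong (λ x → δ i (suc (suc x))) (m+[n∸m]≡n a≤k)))

⊛-scaled-δ : ∀ f g (w : ℕ → ℚ) (e : ℕ → ℕ) → (∀ a → f a 0 ≡ 0ℚ) →
             (∀ k i → g k i ≡ w k ℚ.* δ i (e k)) →
             ∀ n j → (f ⊛ g) n j ≡ sumTo n (λ a → w (n ∸ a) ℚ.* f a (j ∸ e (n ∸ a)))
⊛-scaled-δ f g w e f0≡0 g-coeff n j = sumTo-cong n (λ a _ → column (n ∸ a) a)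
  where
  open ≡-Reasoning
  column : ∀ k a → sumTo j (λ b → f a b ℚ.* g k (j ∸ b)) ≡ w k ℚ.* f a (j ∸ e k)
  column k a = begin
    sumTo j (λ b → f a b ℚ.* g k (j ∸ b))             ≡⟨ sumTo-cong j (λ b _ →
                                                          trans (cong (f a b ℚ.*_) (g-coeff k (j ∸ b)))
                                                                (x∙yz≈y∙xz (f a b) (w k) _)) ⟩
    sumTo j (λ b → w k ℚ.* (f a b ℚ.* δ (j ∸ b) (e k))) ≡⟨ sumTo-*ˡ j (w k) _ ⟩
    w k ℚ.* sumTo j (λ b → f a b ℚ.* δ (j ∸ b) (e k))   ≡⟨ cong (w k ℚ.*_) (sumTo-δ∸ j (e k) (f a) (f0≡0 a)) ⟩
    w k ℚ.* f a (j ∸ e k)                               ∎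

module _ (f : Series2) (f0≡0 : ∀ a → f a 0 ≡ 0ℚ) (n j : ℕ) where

  ⊛-r₁ : (f ⊛ r₁) n j ≡ sumTriangle n (λ s _ → f s j)
  ⊛-r₁ = trans (⊛-scaled-δ f r₁ (λ k → ℕ→ℚ (suc k)) (λ _ → 0) f0≡0 r₁-coeff n j)
               (sym (sumTriangle-first n (λ s → f s j)))

  ⊛-r₂ : (f ⊛ r₂) n j ≡ sumTriangle n (λ s m → f m (j ∸ suc s))
  ⊛-r₂ = begin
    (f ⊛ r₂) n j
      ≡⟨ ⊛-congʳ f r₂-coeff n j ⟩
    sumTo n (λ a → sumTo j (λ b → f a b ℚ.* sumTo (n ∸ a) (λ s → δ (j ∸ b) (suc s))))
      ≡⟨ sumTo-cong n (λ a _ → trans (sumTo-cong j (λ b _ → sym (sumTo-*ˡ (n ∸ a) (f a b) _)))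
                                     (sumTo-swap j (n ∸ a) _)) ⟩
    sumTo n (λ a → sumTo (n ∸ a) (λ s → sumTo j (λ b → f a b ℚ.* δ (j ∸ b) (suc s))))
      ≡⟨ sumTo-cong n (λ a _ → sumTo-cong (n ∸ a) (λ s _ → sumTo-δ∸ j (suc s) (f a) (f0≡0 a))) ⟩
    sumTriangle n (λ a s → f a (j ∸ suc s))
      ≡⟨ sumTriangle-swap n _ ⟩
    sumTriangle n (λ s m → f m (j ∸ suc s))
      ∎
    where open ≡-Reasoning

  ⊛-r₃ : (f ⊛ r₃) n j ≡ sumTriangle n (λ s m → f (n ∸ s ∸ m) (j ∸ suc (suc (s + m))))
  ⊛-r₃ = trans (⊛-scaled-δ f r₃ (λ k → ℕ→ℚ (suc k)) (λ k → suc (suc k)) f0≡0 r₃-coeff n j)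
               (sym (sumTriangle-last n (λ l d → f l (j ∸ suc (suc d)))))

-- For f = Cser P, the cost of the recursive call when the sublists have sizes
-- s, m and n ∸ s ∸ m; a rank below a sublist truncates to 0, where f vanishes.
sublistCost : Series2 → ℕ → ℕ → ℕ → ℕ → ℚ
sublistCost f n j s m = f s j ℚ.+ f m (j ∸ suc s) ℚ.+ f (n ∸ s ∸ m) (j ∸ suc (suc (s + m)))

⊛-r : ∀ f → (∀ a → f a 0 ≡ 0ℚ) → ∀ n j → (f ⊛ r) n j ≡ sumTriangle n (sublistCost f n j)
⊛-r f f0≡0 n j = begin
  (f ⊛ r) n j
    ≡⟨ ⊛-distribˡ-⊕ f (r₁ ⊕ r₂) r₃ n j ⟩
  (f ⊛ (r₁ ⊕ r₂)) n j ℚ.+ (f ⊛ r₃) n j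
    ≡⟨ cong (ℚ._+ (f ⊛ r₃) n j) (⊛-distribˡ-⊕ f r₁ r₂ n j) ⟩
  (f ⊛ r₁) n j ℚ.+ (f ⊛ r₂) n j ℚ.+ (f ⊛ r₃) n j
    ≡⟨ cong₂ ℚ._+_ (cong₂ ℚ._+_ (⊛-r₁ f f0≡0 n j) (⊛-r₂ f f0≡0 n j)) (⊛-r₃ f f0≡0 n j) ⟩
  sumTriangle n small ℚ.+ sumTriangle n medium ℚ.+ sumTriangle n large
    ≡⟨ cong (ℚ._+ sumTriangle n large) (sumTriangle-+ n small medium) ⟨
  sumTriangle n (λ s m → small s m ℚ.+ medium s m) ℚ.+ sumTriangle n large
    ≡⟨ sumTriangle-+ n _ large ⟨
  sumTriangle n (sublistCost f n j)
    ∎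
  where
  open ≡-Reasoning
  small medium large : ℕ → ℕ → ℚ
  small  s m = f s j
  medium s m = f m (j ∸ suc s)
  large  s m = f (n ∸ s ∸ m) (j ∸ suc (suc (s + m)))

-- The recurrence for the expected cost

-- Cser P = rankSeries (Cexp P) by definition.
rankSeries : (ℕ → ℕ → ℚ) → Series2
rankSeries rec n j = if (1 ≤ᵇ j) ∧ (j ≤ᵇ n) then rec n j else 0ℚ

rankSeries-inside : ∀ rec {a b} → 1 ≤ b → b ≤ a → rankSeries rec a b ≡ rec a b
rankSeries-inside rec {a} {suc b} _ b<a with suc b ≤ᵇ a | ≤ᵇ-reflects-≤ (suc b) a
... | true  | _         = refl
... | false | ofⁿ b≮a = contradiction b<a b≮a

rankSeries-above : ∀ rec {a b} → a < b → rankSeries rec a b ≡ 0ℚ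
rankSeries-above rec {a} {suc b} a<b with suc b ≤ᵇ a | ≤ᵇ-reflects-≤ (suc b) a
... | true  | ofʸ b<a = contradiction b<a (<⇒≱ a<b)
... | false | _        = refl

rankSeries-∸ : ∀ rec a {i d} → i ≤ d → rankSeries rec a (i ∸ d) ≡ 0ℚ
rankSeries-∸ rec a i≤d rewrite m≤n⇒m∸n≡0 i≤d = refl

only-first : ∀ {x y z} → y ≡ 0ℚ → z ≡ 0ℚ → x ℚ.+ y ℚ.+ z ≡ x
only-first {x} refl refl = trans (ℚₚ.+-identityʳ (x ℚ.+ 0ℚ)) (ℚₚ.+-identityʳ x)

only-second : ∀ {x y z} → x ≡ 0ℚ → z ≡ 0ℚ → x ℚ.+ y ℚ.+ z ≡ y
only-second {y = y} refl refl = trans (ℚₚ.+-identityʳ (0ℚ ℚ.+ y)) (ℚₚ.+-identityˡ y)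

only-third : ∀ {x y z} → x ≡ 0ℚ → y ≡ 0ℚ → x ℚ.+ y ℚ.+ z ≡ z
only-third {z = z} refl refl = ℚₚ.+-identityˡ z

m+n<o⇒n<o∸m : ∀ m {n o} → m + n < o → n < o ∸ m
m+n<o⇒n<o∸m m {n} {o} m+n<o = m+n≤o⇒m≤o∸n (suc n) (subst (λ x → suc x ≤ o) (+-comm m n) m+n<o)

contrib≡sublistCost : ∀ rec {n i} s m → i ≤ suc n →
                      contrib rec (suc (suc n)) (suc i) s m ≡ sublistCost (rankSeries rec) n (suc i) s m
contrib≡sublistCost rec {n} {i} s m i≤1+n with suc i ≤ᵇ s | ≤ᵇ-reflects-≤ (suc i) s
... | true  | ofʸ i<s =
  sym (only-first (rankSeries-∸ rec m (<⇒≤ i<s)) (rankSeries-∸ rec _ (m≤n⇒m≤1+n (≤-trans (<⇒≤ i<s) (m≤m+n s m)))))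
... | false | ofⁿ i≮s with i ≡ᵇ s | ≡ᵇ-reflects-≡ i s
...   | true  | ofʸ refl =
  sym (only-first (rankSeries-∸ rec m {i} ≤-refl) (rankSeries-∸ rec _ (m≤n⇒m≤1+n (m≤m+n i m))))
...   | false | ofⁿ i≢s with suc i ≤ᵇ suc (s + m) | ≤ᵇ-reflects-≤ (suc i) (suc (s + m))
...     | true  | ofʸ (s≤s i≤s+m) =
  sym (trans (only-second refl (rankSeries-∸ rec _ (m≤n⇒m≤1+n i≤s+m)))
             (rankSeries-inside rec (m<n⇒0<n∸m s<i) (m≤n+o⇒m∸n≤o i s i≤s+m)))
  where
  s<i : s < i
  s<i = ≤∧≢⇒< (≤-pred (≰⇒> i≮s)) (≢-sym i≢s)
...     | false | ofⁿ i≰s+m with i ≡ᵇ suc (s + m) | ≡ᵇ-reflects-≡ i (suc (s + m))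
...       | true  | ofʸ refl =
  sym (only-first (rankSeries-above rec (m+n<o⇒n<o∸m s ≤-refl)) (rankSeries-∸ rec _ {s + m} ≤-refl))
...       | false | ofⁿ i≢1+s+m =
  sym (trans (only-third refl (rankSeries-above rec (m+n<o⇒n<o∸m s s+m<i)))
             (rankSeries-inside rec (m<n⇒0<n∸m 1+s+m<i) l-bound))
  where
  s+m<i : s + m < i
  s+m<i = ≤-pred (≰⇒> i≰s+m)
  1+s+m<i : suc (s + m) < i
  1+s+m<i = ≤∧≢⇒< s+m<i (≢-sym i≢1+s+m)
  l-bound : i ∸ suc (s + m) ≤ n ∸ s ∸ m
  l-bound = ≤-trans (∸-monoˡ-≤ (suc (s + m)) i≤1+n) (≤-reflexive (sym (∸-+-assoc n s m)))

contrib-cong : ∀ {rec₁ rec₂ n} j s m → (∀ a b → a ≤ n → rec₁ a b ≡ rec₂ a b) → s + m ≤ n →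
               contrib rec₁ (suc (suc n)) j s m ≡ contrib rec₂ (suc (suc n)) j s m
contrib-cong {n = n} j s m rec₁≗rec₂ s+m≤n
  rewrite rec₁≗rec₂ s j (m+n≤o⇒m≤o s s+m≤n)
        | rec₁≗rec₂ m (j ∸ suc s) (m+n≤o⇒n≤o s s+m≤n)
        | rec₁≗rec₂ (n ∸ s ∸ m) (j ∸ suc (suc (s + m))) (≤-trans (m∸n≤m (n ∸ s) m) (m∸n≤m n s))
  = refl

costF-fuel : ∀ P {f g a} b → a ≤ f → a ≤ g → costF P f a b ≡ costF P g a b
costF-fuel P {zero}  {zero}  b z≤n z≤n = refl
costF-fuel P {zero}  {suc g} b z≤n z≤n = refl
costF-fuel P {suc f} {zero}  b z≤n z≤n = refl
costF-fuel P {suc f} {suc g} {zero}        b _ _ = refl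
costF-fuel P {suc f} {suc g} {suc zero}    b _ _ = refl
costF-fuel P {suc f} {suc g} {suc (suc k)} b (s≤s k<f) (s≤s k<g) =
  cong (λ x → P (suc (suc k)) ℚ.+ (+ 2 / (suc (suc k) ℕ.* suc k)) ℚ.* x)
       (sumTriangle-cong k (λ s m s+m≤k → contrib-cong b s m (λ a b′ a≤k →
          costF-fuel P b′ (≤-trans a≤k (<⇒≤ k<f)) (≤-trans a≤k (<⇒≤ k<g))) s+m≤k))

Cexp-unfold : ∀ P n j →
  Cexp P (suc (suc n)) j
    ≡ P (suc (suc n)) ℚ.+ (+ 2 / (suc (suc n) ℕ.* suc n)) ℚ.* sumTriangle n (contrib (Cexp P) (suc (suc n)) j)
Cexp-unfold P n j =
  cong (λ x → P (suc (suc n)) ℚ.+ (+ 2 / (suc (suc n) ℕ.* suc n)) ℚ.* x)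
       (sumTriangle-cong n (λ s m s+m≤n → contrib-cong j s m (λ a b a≤n →
          costF-fuel P b (m≤n⇒m≤1+n a≤n) ≤-refl) s+m≤n))

Cexp-recurrence : ∀ P n i → i ≤ suc n →
  Cexp P (suc (suc n)) (suc i)
    ≡ P (suc (suc n)) ℚ.+ (+ 2 / (suc (suc n) ℕ.* suc n)) ℚ.* (Cser P ⊛ r) n (suc i)
Cexp-recurrence P n i i≤1+n = trans (Cexp-unfold P n (suc i))
  (cong (λ x → P (suc (suc n)) ℚ.+ (+ 2 / (suc (suc n) ℕ.* suc n)) ℚ.* x)
        (trans (sumTriangle-cong n (λ s m _ → contrib≡sublistCost (Cexp P) s m i≤1+n))
               (sym (⊛-r (Cser P) (λ _ → refl) n (suc i)))))

⊛-at-u⁰ : ∀ f g → (∀ a → f a 0 ≡ 0ℚ) → ∀ n → (f ⊛ g) n 0 ≡ 0ℚ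
⊛-at-u⁰ f g f0≡0 n = trans
  (sumTo-cong n (λ a _ → trans (cong (ℚ._* g (n ∸ a) 0) (f0≡0 a)) (ℚₚ.*-zeroˡ (g (n ∸ a) 0))))
  (sumTo-0 n)

Cser⊛r-above : ∀ P n j → suc (suc n) < j → (Cser P ⊛ r) n j ≡ 0ℚ
Cser⊛r-above P n j n+2<j = begin
  (Cser P ⊛ r) n j                              ≡⟨ ⊛-r (Cser P) (λ _ → refl) n j ⟩
  sumTriangle n (sublistCost (Cser P) n j)      ≡⟨ sumTriangle-cong n vanish ⟩
  sumTriangle n (λ _ _ → 0ℚ)                    ≡⟨ sumTo-cong n (λ s _ → sumTo-0 (n ∸ s)) ⟩
  sumTo n (λ _ → 0ℚ)                            ≡⟨ sumTo-0 n ⟩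
  0ℚ                                            ∎
  where
  open ≡-Reasoning
  vanish : ∀ s m → s + m ≤ n → sublistCost (Cser P) n j s m ≡ 0ℚ
  vanish s m s+m≤n = trans
    (only-first (rankSeries-above (Cexp P) (m+n<o⇒n<o∸m (suc s) (<-trans (s≤s (s≤s s+m≤n)) n+2<j)))
                (rankSeries-above (Cexp P) (m+n<o⇒n<o∸m (suc (suc (s + m))) (subst (_< j) (sym parts) n+2<j))))
    (rankSeries-above (Cexp P) (<-trans (s≤s (m+n≤o⇒m≤o s s+m≤n)) (<-trans (n<1+n (suc n)) n+2<j)))
    where
    parts : suc (suc (s + m)) + (n ∸ s ∸ m) ≡ suc (suc n)
    parts = cong (λ x → suc (suc x)) (trans (cong (λ x → s + m + x) (∸-+-assoc n s m)) (m+[n∸m]≡n s+m≤n))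

clear-denominator : ∀ d p x →
  ℕ→ℚ (suc d) ℚ.* (p ℚ.+ (+ 2 / suc d) ℚ.* x) ≡ ℕ→ℚ (suc d) ℚ.* p ℚ.+ (+ 2 / 1) ℚ.* x
clear-denominator d p x = begin
  D ℚ.* (p ℚ.+ (+ 2 / suc d) ℚ.* x)           ≡⟨ ℚₚ.*-distribˡ-+ D p _ ⟩
  D ℚ.* p ℚ.+ D ℚ.* ((+ 2 / suc d) ℚ.* x)     ≡⟨ cong (D ℚ.* p ℚ.+_) (ℚₚ.*-assoc D _ x) ⟨
  D ℚ.* p ℚ.+ (D ℚ.* (+ 2 / suc d)) ℚ.* x     ≡⟨ cong (λ c → D ℚ.* p ℚ.+ c ℚ.* x) (ℕ→ℚ-*-/ 2 d) ⟩
  D ℚ.* p ℚ.+ (+ 2 / 1) ℚ.* x                 ∎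
  where
  open ≡-Reasoning
  D : ℚ
  D = ℕ→ℚ (suc d)

-- The z^n coefficient of P''(z); Pterm P n = rankSeries (λ _ _ → P″ P n) (n + 2) by definition.
P″ : (ℕ → ℚ) → ℕ → ℚ
P″ P n = ℕ→ℚ (suc (suc n) ℕ.* suc n) ℚ.* P (suc (suc n))

∂z∂z-Cser-vanishing : ∀ P n j → Cser P (suc (suc n)) j ≡ 0ℚ → Pterm P n j ≡ 0ℚ → (Cser P ⊛ r) n j ≡ 0ℚ →
                      ∂z (∂z (Cser P)) n j ≡ (Pterm P ⊕ (+ 2 / 1) · (Cser P ⊛ r)) n j
∂z∂z-Cser-vanishing P n j C≡0 Pterm≡0 C⊛r≡0 = begin
  ℕ→ℚ (suc n) ℚ.* (ℕ→ℚ (suc (suc n)) ℚ.* Cser P (suc (suc n)) j)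
    ≡⟨ cong (λ x → ℕ→ℚ (suc n) ℚ.* (ℕ→ℚ (suc (suc n)) ℚ.* x)) C≡0 ⟩
  ℕ→ℚ (suc n) ℚ.* (ℕ→ℚ (suc (suc n)) ℚ.* 0ℚ)
    ≡⟨ cong (ℕ→ℚ (suc n) ℚ.*_) (ℚₚ.*-zeroʳ (ℕ→ℚ (suc (suc n)))) ⟩
  ℕ→ℚ (suc n) ℚ.* 0ℚ
    ≡⟨ ℚₚ.*-zeroʳ (ℕ→ℚ (suc n)) ⟩
  0ℚ ℚ.+ (+ 2 / 1) ℚ.* 0ℚ
    ≡⟨ cong₂ (λ x y → x ℚ.+ (+ 2 / 1) ℚ.* y) Pterm≡0 C⊛r≡0 ⟨
  Pterm P n j ℚ.+ (+ 2 / 1) ℚ.* (Cser P ⊛ r) n j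
    ∎
  where open ≡-Reasoning

∂z∂z-Cser-inside : ∀ P n i → i ≤ suc n →
                   ∂z (∂z (Cser P)) n (suc i) ≡ (Pterm P ⊕ (+ 2 / 1) · (Cser P ⊛ r)) n (suc i)
∂z∂z-Cser-inside P n i i≤1+n = begin
  ℕ→ℚ (suc n) ℚ.* (ℕ→ℚ (suc (suc n)) ℚ.* Cser P (suc (suc n)) (suc i))
    ≡⟨ cong (λ x → ℕ→ℚ (suc n) ℚ.* (ℕ→ℚ (suc (suc n)) ℚ.* x)) (rankSeries-inside (Cexp P) 1≤j j≤n+2) ⟩
  ℕ→ℚ (suc n) ℚ.* (ℕ→ℚ (suc (suc n)) ℚ.* Cexp P (suc (suc n)) (suc i))
    ≡⟨ x∙yz≈yx∙z (ℕ→ℚ (suc n)) (ℕ→ℚ (suc (suc n))) _ ⟩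
  (ℕ→ℚ (suc (suc n)) ℚ.* ℕ→ℚ (suc n)) ℚ.* Cexp P (suc (suc n)) (suc i)
    ≡⟨ cong₂ ℚ._*_ (sym (ℕ→ℚ-* (suc (suc n)) (suc n))) (Cexp-recurrence P n i i≤1+n) ⟩
  D ℚ.* (P (suc (suc n)) ℚ.+ (+ 2 / (suc (suc n) ℕ.* suc n)) ℚ.* X)
    ≡⟨ clear-denominator (n + suc n ℕ.* suc n) (P (suc (suc n))) X ⟩
  P″ P n ℚ.+ (+ 2 / 1) ℚ.* X
    ≡⟨ cong (ℚ._+ (+ 2 / 1) ℚ.* X) (rankSeries-inside (λ _ _ → P″ P n) 1≤j j≤n+2) ⟨
  Pterm P n (suc i) ℚ.+ (+ 2 / 1) ℚ.* X
    ∎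
  where
  open ≡-Reasoning
  1≤j : 1 ≤ suc i
  1≤j = s≤s z≤n
  j≤n+2 : suc i ≤ suc (suc n)
  j≤n+2 = s≤s i≤1+n
  D X : ℚ
  D = ℕ→ℚ (suc (suc n) ℕ.* suc n)
  X = (Cser P ⊛ r) n (suc i)

∂z∂z-Cser : ∀ P n j → ∂z (∂z (Cser P)) n j ≡ (Pterm P ⊕ (+ 2 / 1) · (Cser P ⊛ r)) n j
∂z∂z-Cser P n zero = ∂z∂z-Cser-vanishing P n 0 refl refl (⊛-at-u⁰ (Cser P) r (λ _ → refl) n)
∂z∂z-Cser P n (suc i) with i ≤? suc n
... | yes i≤1+n = ∂z∂z-Cser-inside P n i i≤1+n
... | no  i≰1+n = ∂z∂z-Cser-vanishing P n (suc i)
  (rankSeries-above (Cexp P) n+2<j) (rankSeries-above (λ _ _ → P″ P n) n+2<j) (Cser⊛r-above P n (suc i) n+2<j)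
  where
  n+2<j : suc (suc n) < suc i
  n+2<j = s≤s (≰⇒> i≰1+n)

-- Row sums (the substitution u = 1)

sumTo-rankSeries-const : ∀ M x → sumTo (suc M) (rankSeries (λ _ _ → x) (suc M)) ≡ ℕ→ℚ (suc M) ℚ.* x
sumTo-rankSeries-const M x = begin
  sumTo (suc M) (rankSeries (λ _ _ → x) (suc M))
    ≡⟨ sumTo-head M _ ⟩
  0ℚ ℚ.+ sumTo M (λ t → rankSeries (λ _ _ → x) (suc M) (suc t)) ≡⟨ ℚₚ.+-identityˡ _ ⟩
  sumTo M (λ t → rankSeries (λ _ _ → x) (suc M) (suc t))
    ≡⟨ sumTo-cong M (λ t t≤M →
        rankSeries-inside (λ _ _ → x) (s≤s z≤n) (s≤s t≤M)) ⟩
  sumTo M (λ _ → x)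
    ≡⟨ sumTo-const M x ⟩
  ℕ→ℚ (suc M) ℚ.* x
    ∎
  where open ≡-Reasoning

module _ (f : Series2) (f0≡0 : ∀ a → f a 0 ≡ 0ℚ) (f-above : ∀ a b → a < b → f a b ≡ 0ℚ) where

  sumTo-shifted-row : ∀ N c a → c + a ≤ N → sumTo N (λ j → f a (j ∸ c)) ≡ sumTo a (f a)
  sumTo-shifted-row N c a c+a≤N = begin
    sumTo N (λ j → f a (j ∸ c))             ≡⟨ cong (λ M → sumTo M (λ j → f a (j ∸ c))) (m+[n∸m]≡n c≤N) ⟨
    sumTo (c + (N ∸ c)) (λ j → f a (j ∸ c)) ≡⟨ sumTo-∸-shift c (N ∸ c) (f a) (f0≡0 a) ⟩
    sumTo (N ∸ c) (f a)                     ≡⟨ sumTo-extend (f a) a≤N∸c (f-above a) ⟩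
    sumTo a (f a)                           ∎
    where
    open ≡-Reasoning
    c≤N : c ≤ N
    c≤N = m+n≤o⇒m≤o c c+a≤N
    a≤N∸c : a ≤ N ∸ c
    a≤N∸c = m+n≤o⇒m≤o∸n a (subst (_≤ N) (+-comm c a) c+a≤N)

  sumTo-sublistCost : ∀ n s m → s + m ≤ n →
    sumTo (suc (suc n)) (λ j → sublistCost f n j s m)
      ≡ sumTo s (f s) ℚ.+ sumTo m (f m) ℚ.+ sumTo (n ∸ s ∸ m) (f (n ∸ s ∸ m))
  sumTo-sublistCost n s m s+m≤n = begin
    sumTo N (λ j → sublistCost f n j s m)
      ≡⟨ sumTo-+ N _ _ ⟩
    sumTo N (λ j → f s j ℚ.+ f m (j ∸ suc s)) ℚ.+ sumTo N (λ j → f l (j ∸ suc (suc (s + m))))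
      ≡⟨ cong (ℚ._+ sumTo N (λ j → f l (j ∸ suc (suc (s + m))))) (sumTo-+ N _ _) ⟩
    sumTo N (f s) ℚ.+ sumTo N (λ j → f m (j ∸ suc s)) ℚ.+ sumTo N (λ j → f l (j ∸ suc (suc (s + m))))
      ≡⟨ cong₂ ℚ._+_ (cong₂ ℚ._+_ (sumTo-shifted-row N 0 s s≤N)
                                   (sumTo-shifted-row N (suc s) m (s≤s (m≤n⇒m≤1+n s+m≤n))))
                     (sumTo-shifted-row N (suc (suc (s + m))) l (≤-reflexive parts)) ⟩
    sumTo s (f s) ℚ.+ sumTo m (f m) ℚ.+ sumTo l (f l)
      ∎
    where
    open ≡-Reasoning
    N l : ℕ
    N = suc (suc n)
    l = n ∸ s ∸ m
    s≤N : s ≤ N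
    s≤N = ≤-trans (m+n≤o⇒m≤o s s+m≤n) (≤-trans (n≤1+n n) (n≤1+n (suc n)))
    parts : suc (suc (s + m)) + l ≡ N
    parts = cong (λ x → suc (suc x)) (trans (cong (λ x → s + m + x) (∸-+-assoc n s m)) (m+[n∸m]≡n s+m≤n))

  sumTo-⊛r : ∀ n → let W = sumTo n (λ a → ℕ→ℚ (suc (n ∸ a)) ℚ.* sumTo a (f a)) in
             sumTo (suc (suc n)) (λ j → (f ⊛ r) n j) ≡ W ℚ.+ W ℚ.+ W
  sumTo-⊛r n = begin
    sumTo N (λ j → (f ⊛ r) n j)
      ≡⟨ sumTo-cong N (λ j _ → ⊛-r f f0≡0 n j) ⟩
    sumTo N (λ j → sumTriangle n (sublistCost f n j))
      ≡⟨ sumTo-sumTriangle N n _ ⟩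
    sumTriangle n (λ s m → sumTo N (λ j → sublistCost f n j s m))
      ≡⟨ sumTriangle-cong n (sumTo-sublistCost n) ⟩
    sumTriangle n (λ s m → F s ℚ.+ F m ℚ.+ F (n ∸ s ∸ m))
      ≡⟨ sumTriangle-+ n _ _ ⟩
    sumTriangle n (λ s m → F s ℚ.+ F m) ℚ.+ sumTriangle n (λ s m → F (n ∸ s ∸ m))
      ≡⟨ cong (ℚ._+ sumTriangle n (λ s m → F (n ∸ s ∸ m))) (sumTriangle-+ n _ _) ⟩
    sumTriangle n (λ s _ → F s) ℚ.+ sumTriangle n (λ _ m → F m) ℚ.+ sumTriangle n (λ s m → F (n ∸ s ∸ m))
      ≡⟨ cong₂ ℚ._+_ (cong₂ ℚ._+_ (sumTriangle-first n F)
                                   (trans (sumTriangle-swap n (λ _ m → F m)) (sumTriangle-first n F)))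
                     (sumTriangle-last n (λ l _ → F l)) ⟩
    W ℚ.+ W ℚ.+ W
      ∎
    where
    open ≡-Reasoning
    N : ℕ
    N = suc (suc n)
    F : ℕ → ℚ
    F a = sumTo a (f a)
    W : ℚ
    W = sumTo n (λ a → ℕ→ℚ (suc (n ∸ a)) ℚ.* F a)

geo₁⊛₁geo₁⊛₁-coeff : ∀ g n → (geo₁ ⊛₁ geo₁ ⊛₁ g) n ≡ sumTo n (λ a → ℕ→ℚ (suc (n ∸ a)) ℚ.* g a)
geo₁⊛₁geo₁⊛₁-coeff g n = begin
  sumTo n (λ a → sumTo a (λ _ → 1ℚ ℚ.* 1ℚ) ℚ.* g (n ∸ a))
    ≡⟨ sumTo-cong n (λ a _ →
        cong (ℚ._* g (n ∸ a)) (geo₁⊛₁geo₁ a)) ⟩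
  sumTo n (λ a → ℕ→ℚ (suc a) ℚ.* g (n ∸ a))
    ≡⟨ sumTo-reverse n _ ⟩
  sumTo n (λ a → ℕ→ℚ (suc (n ∸ a)) ℚ.* g (n ∸ (n ∸ a)))
    ≡⟨ sumTo-cong n (λ a a≤n →
        cong (λ x → ℕ→ℚ (suc (n ∸ a)) ℚ.* g x) (m∸[m∸n]≡n a≤n)) ⟩
  sumTo n (λ a → ℕ→ℚ (suc (n ∸ a)) ℚ.* g a)
    ∎
  where
  open ≡-Reasoning
  geo₁⊛₁geo₁ : ∀ a → (geo₁ ⊛₁ geo₁) a ≡ ℕ→ℚ (suc a)
  geo₁⊛₁geo₁ a = trans (sumTo-const a (1ℚ ℚ.* 1ℚ)) (ℚₚ.*-identityʳ (ℕ→ℚ (suc a)))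

atU1-∂z∂z-Cser : ∀ P n →
  atU1 (λ k → k + 2) (∂z (∂z (Cser P))) n
    ≡ (z⁻¹· (d₁ (z²· (d₁ (d₁ P)))) ⊕₁ (+ 6 / 1) ·₁ (geo₁ ⊛₁ geo₁ ⊛₁ atU1 (λ k → k) (Cser P))) n
atU1-∂z∂z-Cser P n = begin
  sumTo (n + 2) (λ j → ∂z (∂z (Cser P)) n j)
    ≡⟨ cong (λ M → sumTo M (λ j → ∂z (∂z (Cser P)) n j)) (+-comm n 2) ⟩
  sumTo N (λ j → ∂z (∂z (Cser P)) n j)
    ≡⟨ sumTo-cong N (λ j _ → ∂z∂z-Cser P n j) ⟩
  sumTo N (λ j → Pterm P n j ℚ.+ (+ 2 / 1) ℚ.* (Cser P ⊛ r) n j)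
    ≡⟨ sumTo-+ N _ _ ⟩
  sumTo N (Pterm P n) ℚ.+ sumTo N (λ j → (+ 2 / 1) ℚ.* (Cser P ⊛ r) n j)
    ≡⟨ cong₂ ℚ._+_ (sumTo-rankSeries-const (suc n) (P″ P n))
                   (trans (sumTo-*ˡ N (+ 2 / 1) _) (cong ((+ 2 / 1) ℚ.*_) Cser⊛r-row)) ⟩
  ℕ→ℚ N ℚ.* (ℕ→ℚ (N ℕ.* suc n) ℚ.* P N) ℚ.+ (+ 2 / 1) ℚ.* (W ℚ.+ W ℚ.+ W)
    ≡⟨ cong₂ ℚ._+_ (cong (ℕ→ℚ N ℚ.*_) reorder)
                   (solve 1 (λ w → con (+ 2 / 1) :* (w :+ w :+ w) := con (+ 6 / 1) :* w) refl W) ⟩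
  ℕ→ℚ N ℚ.* (ℕ→ℚ (suc n) ℚ.* (ℕ→ℚ N ℚ.* P N)) ℚ.+ (+ 6 / 1) ℚ.* W
    ≡⟨ cong (λ x → ℕ→ℚ N ℚ.* (ℕ→ℚ (suc n) ℚ.* (ℕ→ℚ N ℚ.* P N)) ℚ.+ (+ 6 / 1) ℚ.* x)
            (geo₁⊛₁geo₁⊛₁-coeff (atU1 (λ k → k) (Cser P)) n) ⟨
  (z⁻¹· (d₁ (z²· (d₁ (d₁ P)))) ⊕₁ (+ 6 / 1) ·₁ (geo₁ ⊛₁ geo₁ ⊛₁ atU1 (λ k → k) (Cser P))) n
    ∎
  where
  open ≡-Reasoning
  open +-*-Solver
  N : ℕ
  N = suc (suc n)
  W : ℚ
  W = sumTo n (λ a → ℕ→ℚ (suc (n ∸ a)) ℚ.* sumTo a (Cser P a))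
  Cser⊛r-row : sumTo N (λ j → (Cser P ⊛ r) n j) ≡ W ℚ.+ W ℚ.+ W
  Cser⊛r-row = sumTo-⊛r (Cser P) (λ _ → refl) (λ _ _ → rankSeries-above (Cexp P)) n
  reorder : ℕ→ℚ (N ℕ.* suc n) ℚ.* P N ≡ ℕ→ℚ (suc n) ℚ.* (ℕ→ℚ N ℚ.* P N)
  reorder = trans (cong (ℚ._* P N) (ℕ→ℚ-* N (suc n))) (xy∙z≈y∙xz (ℕ→ℚ N) (ℕ→ℚ (suc n)) (P N))

proposition3p2 : (P : ℕ → ℚ) → P 0 ≡ 0ℚ → P 1 ≡ 0ℚ →
    ((n j : ℕ) →
      ∂z (∂z (Cser P)) n j ≡ (Pterm P ⊕ (+ 2 / 1) · (Cser P ⊛ r)) n j)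
    × ((n : ℕ) →
      atU1 (λ k → k + 2) (∂z (∂z (Cser P))) n
        ≡ (z⁻¹· (d₁ (z²· (d₁ (d₁ P)))) ⊕₁ (+ 6 / 1) ·₁ (geo₁ ⊛₁ geo₁ ⊛₁ atU1 (λ k → k) (Cser P))) n)
-- The coefficients never involve P 0 and P 1, so those hypotheses go unused.
proposition3p2 P _ _ = ∂z∂z-Cser P , atU1-∂z∂z-Cser P
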